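{- Let $k \geq 2$ be an integer. Let $g = 2^\ell \cdot f$ be a positive integer, where $\ell \geq 0$ is an integer and $f \geq 1$ is odd. Then for every integer $n \geq kf + \ell + \log_2 f$, the number $\left\lfloor \frac{2^n}{g} \right\rfloor$ can be written as the sum of at most $2^{kf-1}$ binary $k$'th powers and an integer $t$ with $0 \leq t \leq 2^{kf-1}$.
   Context: For integers $k,n \geq 1$ let $c_k(n) := \frac{2^{kn}-1}{2^n-1}$. A natural number is a binary $k$'th power if its canonical binary representation (no leading zeros) consists of $k$ consecutive identical blocks; equivalently, it is $0$ or of the form $a \cdot c_k(n)$ with $n \geq 1$ and $2^{n-1} \leq a < 2^n$. Sums may repeat terms. -}

module Defs where

open import Data.Nat using (ℕ; zero; suc; _+_; _*_; _∸_; _^_; _≤_; _<_)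
open import Data.Nat.DivMod using (_/_)
open import Data.Product using (Σ; _×_; ∃-syntax)
open import Data.Sum using (_⊎_)
open import Relation.Binary.PropositionalEquality using (_≡_)

_div_ : ℕ → ℕ → ℕ
x div zero = 0
x div (suc d) = x / suc d

c : ℕ → ℕ → ℕ
c k n = (2 ^ (k * n) ∸ 1) div (2 ^ n ∸ 1)

BinaryPower : ℕ → ℕ → Set
BinaryPower k x =
  x ≡ 0 ⊎ (∃[ n ] ∃[ a ] (1 ≤ n × 2 ^ (n ∸ 1) ≤ a × a < 2 ^ n × x ≡ a * c k n))

-- Let r = ⌊log₂ f⌋ and let d ≤ f be a period of 2 modulo the odd number f. Split the exponent as
-- n = ℓ + r + s + kN with N a multiple of d and s < kd ≤ kf. Since f ∣ 2^N - 1, say fB = 2^N - 1, and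
-- 2^(kN) - 1 = (2^N - 1) c_k(N), we get 2^n = 2^(ℓ+r+s) + 2^ℓ f · 2^s (2^r B) c_k(N). So ⌊2^n / g⌋ is
-- 2^s copies of (2^r B) c_k(N) plus ⌊2^(r+s) / f⌋ ≤ 2^s, and 2^r ≤ f < 2^(r+1) makes 2^r B an N-bit
-- number, i.e. (2^r B) c_k(N) a binary k'th power.
module Submission where

open import Defs
open import Data.Nat using (ℕ; zero; suc; _+_; _*_; _∸_; _^_; _≤_; _<_; _%_; _/_; NonZero; >-nonZero; z≤n; s≤s; _<?_)
open import Data.Nat.Properties
open import Data.Nat.DivMod using (_mod_; m≡m%n+[m/n]*n; m%n<n; m*n/n≡m; m≥n⇒m/n>0; +-distrib-/-∣ʳ; /-monoˡ-≤)
open import Data.Nat.Divisibility using (_∣_; divides; ∣-trans; ∣⇒≤; n∣m*n; n∣m⇒m%n≡0)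
open import Data.Nat.Coprimality using (Coprime; coprime-divisor)
open import Data.Nat.Primality using (irreducible[2])
open import Data.Nat.Tactic.RingSolver using (solve-∀)
open import Data.Nat.ListAction using (sum)
open import Data.Fin using (toℕ)
open import Data.Fin.Properties using (pigeonhole; fromℕ<-injective; toℕ<n)
open import Data.List using (replicate; length)
open import Data.List.Properties using (length-replicate)
open import Data.List.Relation.Unary.All using (All)
open import Data.List.Relation.Unary.All.Properties using (replicate⁺)
open import Data.Product using (_×_; ∃-syntax; _,_)
open import Data.Sum using (inj₁; inj₂)
open import Relation.Nullary using (yes; no; contradiction)
open import Relation.Binary.PropositionalEquality

geometric : ℕ → ℕ → ℕ
geometric zero    N = 0
geometric (suc k) N = 1 + 2 ^ N * geometric k N

[2^N∸1]*geometric+1≡2^[k*N] : ∀ k N → (2 ^ N ∸ 1) * geometric k N + 1 ≡ 2 ^ (k * N)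
[2^N∸1]*geometric+1≡2^[k*N] zero    N = cong (_+ 1) (*-zeroʳ (2 ^ N ∸ 1))
[2^N∸1]*geometric+1≡2^[k*N] (suc k) N = begin
  P * (1 + 2 ^ N * G) + 1    ≡⟨ cong (λ q → P * (1 + q * G) + 1) P+1≡2^N ⟨
  P * (1 + (P + 1) * G) + 1  ≡⟨ telescope P G ⟩
  (P + 1) * (P * G + 1)      ≡⟨ cong₂ _*_ P+1≡2^N ([2^N∸1]*geometric+1≡2^[k*N] k N) ⟩
  2 ^ N * 2 ^ (k * N)        ≡⟨ ^-distribˡ-+-* 2 N (k * N) ⟨
  2 ^ (suc k * N)            ∎
  where
  open ≡-Reasoning
  P = 2 ^ N ∸ 1
  G = geometric k N
  P+1≡2^N : P + 1 ≡ 2 ^ N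
  P+1≡2^N = m∸n+n≡m (m^n>0 2 N)
  telescope : ∀ p g → p * (1 + (p + 1) * g) + 1 ≡ (p + 1) * (p * g + 1)
  telescope = solve-∀

2^N∸1∣2^[k*N]∸1 : ∀ k N → 2 ^ N ∸ 1 ∣ 2 ^ (k * N) ∸ 1
2^N∸1∣2^[k*N]∸1 k N = divides (geometric k N) (begin
  2 ^ (k * N) ∸ 1                          ≡⟨ cong (_∸ 1) ([2^N∸1]*geometric+1≡2^[k*N] k N) ⟨
  (2 ^ N ∸ 1) * geometric k N + 1 ∸ 1      ≡⟨ m+n∸n≡m _ 1 ⟩
  (2 ^ N ∸ 1) * geometric k N              ≡⟨ *-comm (2 ^ N ∸ 1) _ ⟩
  geometric k N * (2 ^ N ∸ 1)              ∎)
  where open ≡-Reasoning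

div≡/ : ∀ m n .{{_ : NonZero n}} → m div n ≡ m / n
div≡/ m (suc n) = refl

c≡geometric : ∀ k N → 1 ≤ N → c k N ≡ geometric k N
c≡geometric k N 1≤N = begin
  (2 ^ (k * N) ∸ 1) div P          ≡⟨ cong (λ x → (x ∸ 1) div P) ([2^N∸1]*geometric+1≡2^[k*N] k N) ⟨
  (P * G + 1 ∸ 1) div P            ≡⟨ cong (_div P) (m+n∸n≡m (P * G) 1) ⟩
  (P * G) div P                    ≡⟨ div≡/ (P * G) P ⟩
  P * G / P                        ≡⟨ cong (_/ P) (*-comm P G) ⟩
  G * P / P                        ≡⟨ m*n/n≡m G P ⟩
  G                                ∎
  where
  open ≡-Reasoning
  P = 2 ^ N ∸ 1
  G = geometric k N
  instance
    P≢0 : NonZero P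
    P≢0 = >-nonZero (∸-monoˡ-≤ 1 (^-monoʳ-≤ 2 1≤N))

2^[k*N]≡[2^N∸1]*c+1 : ∀ k N → 1 ≤ N → 2 ^ (k * N) ≡ (2 ^ N ∸ 1) * c k N + 1
2^[k*N]≡[2^N∸1]*c+1 k N 1≤N = begin
  2 ^ (k * N)                       ≡⟨ [2^N∸1]*geometric+1≡2^[k*N] k N ⟨
  (2 ^ N ∸ 1) * geometric k N + 1   ≡⟨ cong (λ x → (2 ^ N ∸ 1) * x + 1) (c≡geometric k N 1≤N) ⟨
  (2 ^ N ∸ 1) * c k N + 1           ∎
  where open ≡-Reasoning

odd⇒coprime-2 : ∀ {n} → n % 2 ≡ 1 → Coprime n 2
odd⇒coprime-2 {n} odd (d∣n , d∣2) with irreducible[2] d∣2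
... | inj₁ d≡1 = d≡1
... | inj₂ refl = contradiction (trans (sym (n∣m⇒m%n≡0 n 2 d∣n)) odd) λ ()

coprime-divisor-^ : ∀ {m n} → Coprime m n → ∀ a {o} → m ∣ n ^ a * o → m ∣ o
coprime-divisor-^ {m} cop zero {o} m∣o = subst (m ∣_) (*-identityˡ o) m∣o
coprime-divisor-^ {m} {n} cop (suc a) {o} m∣n*n^a*o =
  coprime-divisor-^ cop a (coprime-divisor cop (subst (m ∣_) (*-assoc n (n ^ a) o) m∣n*n^a*o))

%-cong⇒∣∸ : ∀ m n d .{{_ : NonZero d}} → m % d ≡ n % d → d ∣ n ∸ m
%-cong⇒∣∸ m n d m%d≡n%d = divides (n / d ∸ m / d) (begin
  n ∸ m                                    ≡⟨ cong₂ _∸_ (m≡m%n+[m/n]*n n d) (m≡m%n+[m/n]*n m d) ⟩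
  (n % d + n / d * d) ∸ (m % d + m / d * d) ≡⟨ cong (λ x → (n % d + n / d * d) ∸ (x + m / d * d)) m%d≡n%d ⟩
  (n % d + n / d * d) ∸ (n % d + m / d * d) ≡⟨ [m+n]∸[m+o]≡n∸o (n % d) _ _ ⟩
  n / d * d ∸ m / d * d                    ≡⟨ *-distribʳ-∸ d (n / d) (m / d) ⟨
  (n / d ∸ m / d) * d                      ∎)
  where open ≡-Reasoning

-- The residues b^0, …, b^f mod f collide; cancelling the common power of b leaves the period.
multiplicative-period : ∀ {b f} .{{_ : NonZero f}} → Coprime f b → ∃[ d ] (1 ≤ d × d ≤ f × f ∣ b ^ d ∸ 1)
multiplicative-period {b} {f} cop with pigeonhole (n<1+n f) (λ i → b ^ toℕ i mod f)
... | i , j , i<j , b^i≡b^j = e , m<n⇒0<n∸m i<j , e≤f , f∣b^e∸1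
  where
  open ≡-Reasoning
  e = toℕ j ∸ toℕ i
  e≤f : e ≤ f
  e≤f = ≤-trans (m∸n≤m (toℕ j) (toℕ i)) (≤-pred (toℕ<n j))
  b^j∸b^i≡b^i*[b^e∸1] : b ^ toℕ j ∸ b ^ toℕ i ≡ b ^ toℕ i * (b ^ e ∸ 1)
  b^j∸b^i≡b^i*[b^e∸1] = begin
    b ^ toℕ j ∸ b ^ toℕ i               ≡⟨ cong (λ x → b ^ x ∸ b ^ toℕ i) (m+[n∸m]≡n (<⇒≤ i<j)) ⟨
    b ^ (toℕ i + e) ∸ b ^ toℕ i         ≡⟨ cong₂ _∸_ (^-distribˡ-+-* b (toℕ i) e) (sym (*-identityʳ (b ^ toℕ i))) ⟩
    b ^ toℕ i * b ^ e ∸ b ^ toℕ i * 1   ≡⟨ *-distribˡ-∸ (b ^ toℕ i) (b ^ e) 1 ⟨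
    b ^ toℕ i * (b ^ e ∸ 1)             ∎
  f∣b^j∸b^i : f ∣ b ^ toℕ j ∸ b ^ toℕ i
  f∣b^j∸b^i = %-cong⇒∣∸ (b ^ toℕ i) (b ^ toℕ j) f (fromℕ<-injective _ _ (m%n<n _ f) (m%n<n _ f) b^i≡b^j)
  f∣b^e∸1 : f ∣ b ^ e ∸ 1
  f∣b^e∸1 = coprime-divisor-^ cop (toℕ i) (subst (f ∣_) b^j∸b^i≡b^i*[b^e∸1] f∣b^j∸b^i)

n<2^n : ∀ n → n < 2 ^ n
n<2^n zero    = s≤s z≤n
n<2^n (suc n) = +-mono-≤ (m^n>0 2 n) (≤-trans (n<2^n n) (m≤m+n (2 ^ n) 0))

binary-length : ∀ {f} → 1 ≤ f → ∃[ r ] (2 ^ r ≤ f × f < 2 ^ suc r)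
binary-length {f} 1≤f = below f (n<2^n f)
  where
  below : ∀ b → f < 2 ^ b → ∃[ r ] (2 ^ r ≤ f × f < 2 ^ suc r)
  below zero    f<1 = contradiction 1≤f (<⇒≱ f<1)
  below (suc b) f<2^1+b with f <? 2 ^ b
  ... | yes f<2^b = below b f<2^b
  ... | no  f≮2^b = b , ≮⇒≥ f≮2^b , f<2^1+b

2^-cancel-≤ : ∀ {m n} → 2 ^ m ≤ 2 ^ n → m ≤ n
2^-cancel-≤ 2^m≤2^n = ≮⇒≥ (λ n<m → <⇒≱ (^-monoʳ-< 2 ≤-refl n<m) 2^m≤2^n)

2^-cancel-< : ∀ {m n} → 2 ^ m < 2 ^ n → m < n
2^-cancel-< 2^m<2^n = ≰⇒> (λ n≤m → <⇒≱ 2^m<2^n (^-monoʳ-≤ 2 n≤m))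

∣-pred⇒< : ∀ {m n} → 2 ≤ n → m ∣ n ∸ 1 → m < n
∣-pred⇒< {n = suc (suc _)} _         m∣n∸1 = s≤s (∣⇒≤ m∣n∸1)
∣-pred⇒< {n = suc zero}    (s≤s ()) _

exponent-bound : ∀ {f r m ℓ n} → 2 ^ r ≤ f → f * 2 ^ (m + ℓ) ≤ 2 ^ n → (ℓ + r) + m ≤ n
exponent-bound {f} {r} {m} {ℓ} {n} 2^r≤f f*2^[m+ℓ]≤2^n = 2^-cancel-≤ (begin
  2 ^ ((ℓ + r) + m)     ≡⟨ cong (2 ^_) (reorder ℓ r m) ⟩
  2 ^ (r + (m + ℓ))     ≡⟨ ^-distribˡ-+-* 2 r (m + ℓ) ⟩
  2 ^ r * 2 ^ (m + ℓ)   ≤⟨ *-monoˡ-≤ (2 ^ (m + ℓ)) 2^r≤f ⟩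
  f * 2 ^ (m + ℓ)       ≤⟨ f*2^[m+ℓ]≤2^n ⟩
  2 ^ n                 ∎)
  where
  open ≤-Reasoning
  reorder : ∀ ℓ r m → (ℓ + r) + m ≡ r + (m + ℓ)
  reorder = solve-∀

exponent-split : ∀ {k d f e n} → 1 ≤ k → 1 ≤ d → d ≤ f → e + k * f ≤ n →
  ∃[ s ] ∃[ j ] (1 ≤ j × s < k * f × n ≡ e + (s + k * (j * d)))
exponent-split {k} {d} {f} {e} {n} 1≤k 1≤d d≤f e+kf≤n =
  M % p , M / p , m≥n⇒m/n>0 p≤M , <-≤-trans (m%n<n M p) p≤kf , n≡e+[s+k*[j*d]]
  where
  open ≡-Reasoning
  p = k * d
  M = n ∸ e
  instance
    p≢0 : NonZero p
    p≢0 = >-nonZero (*-mono-≤ 1≤k 1≤d)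
  p≤kf : p ≤ k * f
  p≤kf = *-monoʳ-≤ k d≤f
  p≤M : p ≤ M
  p≤M = ≤-trans p≤kf (subst (_≤ M) (m+n∸m≡n e (k * f)) (∸-monoˡ-≤ e e+kf≤n))
  reorder : ∀ q k d → q * (k * d) ≡ k * (q * d)
  reorder = solve-∀
  n≡e+[s+k*[j*d]] : n ≡ e + (M % p + k * (M / p * d))
  n≡e+[s+k*[j*d]] = begin
    n                             ≡⟨ m+[n∸m]≡n (≤-trans (m≤m+n e (k * f)) e+kf≤n) ⟨
    e + M                         ≡⟨ cong (e +_) (m≡m%n+[m/n]*n M p) ⟩
    e + (M % p + M / p * p)       ≡⟨ cong (λ x → e + (M % p + x)) (reorder (M / p) k d) ⟩
    e + (M % p + k * (M / p * d)) ∎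

block-bounds : ∀ {f r N B} → 2 ^ r ≤ f → f < 2 ^ suc r → r < N → f * B + 1 ≡ 2 ^ N →
  2 ^ (N ∸ 1) ≤ 2 ^ r * B × 2 ^ r * B < 2 ^ N
block-bounds {f} {r} {suc N} {B} 2^r≤f f<2^1+r (s≤s r≤N) f*B+1≡2^N = lower , upper
  where
  instance
    f≢0 : NonZero f
    f≢0 = >-nonZero (≤-trans (m^n>0 2 r) 2^r≤f)
  a = 2 ^ r * B
  f*a+2^r≡2^r*2^N : f * a + 2 ^ r ≡ 2 ^ r * 2 ^ suc N
  f*a+2^r≡2^r*2^N = trans (factor f (2 ^ r) B) (cong (2 ^ r *_) f*B+1≡2^N)
    where
    factor : ∀ f y b → f * (y * b) + y ≡ y * (f * b + 1)
    factor = solve-∀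
  lower : 2 ^ N ≤ a
  lower = *-cancelˡ-≤ f (+-cancelʳ-≤ (2 ^ N) _ _ (begin
    f * 2 ^ N + 2 ^ N    ≡⟨ expand f (2 ^ N) ⟩
    suc f * 2 ^ N        ≤⟨ *-monoˡ-≤ (2 ^ N) f<2^1+r ⟩
    2 ^ suc r * 2 ^ N    ≡⟨ shift (2 ^ r) (2 ^ N) ⟩
    2 ^ r * 2 ^ suc N    ≡⟨ f*a+2^r≡2^r*2^N ⟨
    f * a + 2 ^ r        ≤⟨ +-monoʳ-≤ (f * a) (^-monoʳ-≤ 2 r≤N) ⟩
    f * a + 2 ^ N        ∎))
    where
    open ≤-Reasoning
    expand : ∀ f p → f * p + p ≡ (1 + f) * p
    expand = solve-∀
    shift : ∀ y p → (2 * y) * p ≡ y * (2 * p)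
    shift = solve-∀
  upper : a < 2 ^ suc N
  upper = *-cancelˡ-< f a (2 ^ suc N) (begin-strict
    f * a                <⟨ m<m+n (f * a) (m^n>0 2 r) ⟩
    f * a + 2 ^ r        ≡⟨ f*a+2^r≡2^r*2^N ⟩
    2 ^ r * 2 ^ suc N    ≤⟨ *-monoˡ-≤ (2 ^ suc N) 2^r≤f ⟩
    f * 2 ^ suc N        ∎)
    where open ≤-Reasoning

sum-replicate : ∀ m x → sum (replicate m x) ≡ m * x
sum-replicate zero    x = refl
sum-replicate (suc m) x = cong (x +_) (sum-replicate m x)

[m+n*o]/o≡n+m/o : ∀ m n o .{{_ : NonZero o}} → (m + n * o) / o ≡ n + m / o
[m+n*o]/o≡n+m/o m n o = begin
  (m + n * o) / o      ≡⟨ +-distrib-/-∣ʳ m (n∣m*n n) ⟩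
  m / o + n * o / o    ≡⟨ cong (m / o +_) (m*n/n≡m n o) ⟩
  m / o + n            ≡⟨ +-comm (m / o) n ⟩
  n + m / o            ∎
  where open ≡-Reasoning

2^-expansion : ∀ {k f N B} ℓ r s → 1 ≤ N → f * B + 1 ≡ 2 ^ N →
  2 ^ (ℓ + (r + (s + k * N))) ≡ 2 ^ ℓ * 2 ^ r * 2 ^ s + 2 ^ s * (2 ^ r * B * c k N) * (2 ^ ℓ * f)
2^-expansion {k} {f} {N} {B} ℓ r s 1≤N f*B+1≡2^N = begin
  2 ^ (ℓ + (r + (s + k * N)))                  ≡⟨ ^-distribˡ-+-* 2 ℓ _ ⟩
  X * 2 ^ (r + (s + k * N))                    ≡⟨ cong (X *_) (^-distribˡ-+-* 2 r _) ⟩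
  X * (Y * 2 ^ (s + k * N))                    ≡⟨ cong (λ x → X * (Y * x)) (^-distribˡ-+-* 2 s _) ⟩
  X * (Y * (Z * 2 ^ (k * N)))                  ≡⟨ cong (λ x → X * (Y * (Z * x))) (2^[k*N]≡[2^N∸1]*c+1 k N 1≤N) ⟩
  X * (Y * (Z * ((2 ^ N ∸ 1) * C + 1)))        ≡⟨ cong (λ x → X * (Y * (Z * (x * C + 1)))) 2^N∸1≡f*B ⟩
  X * (Y * (Z * (f * B * C + 1)))              ≡⟨ distribute X Y Z f B C ⟩
  X * Y * Z + Z * (Y * B * C) * (X * f)        ∎
  where
  open ≡-Reasoning
  X = 2 ^ ℓ
  Y = 2 ^ r
  Z = 2 ^ s
  C = c k N
  2^N∸1≡f*B : 2 ^ N ∸ 1 ≡ f * B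
  2^N∸1≡f*B = trans (cong (_∸ 1) (sym f*B+1≡2^N)) (m+n∸n≡m (f * B) 1)
  distribute : ∀ x y z f b c → x * (y * (z * (f * b * c + 1))) ≡ x * y * z + z * (y * b * c) * (x * f)
  distribute = solve-∀

quotient-decomposition : ∀ {k f r N} ℓ s → 2 ^ r ≤ f → f < 2 ^ suc r → r < N → f ∣ 2 ^ N ∸ 1 →
  ∃[ xs ] ∃[ t ] (length xs ≡ 2 ^ s × All (BinaryPower k) xs × t ≤ 2 ^ s ×
                  (2 ^ (ℓ + (r + (s + k * N)))) div (2 ^ ℓ * f) ≡ sum xs + t)
quotient-decomposition {k} {f} {r} {N} ℓ s 2^r≤f f<2^1+r r<N (divides B 2^N∸1≡B*f) =
  replicate Z block , t , length-replicate Z , replicate⁺ Z block-binaryPower , t≤Z , floor-eq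
  where
  open ≡-Reasoning
  X = 2 ^ ℓ
  Y = 2 ^ r
  Z = 2 ^ s
  block = Y * B * c k N
  1≤N : 1 ≤ N
  1≤N = ≤-trans (s≤s z≤n) r<N
  f*B+1≡2^N : f * B + 1 ≡ 2 ^ N
  f*B+1≡2^N = trans (cong (_+ 1) (trans (*-comm f B) (sym 2^N∸1≡B*f))) (m∸n+n≡m (m^n>0 2 N))
  block-binaryPower : BinaryPower k block
  block-binaryPower =
    let (lower , upper) = block-bounds 2^r≤f f<2^1+r r<N f*B+1≡2^N
    in inj₂ (N , Y * B , 1≤N , lower , upper , refl)
  instance
    X*f≢0 : NonZero (X * f)
    X*f≢0 = >-nonZero (*-mono-≤ (m^n>0 2 ℓ) (≤-trans (m^n>0 2 r) 2^r≤f))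
  t = X * Y * Z / (X * f)
  t≤Z : t ≤ Z
  t≤Z = ≤-trans (/-monoˡ-≤ (X * f) X*Y*Z≤Z*[X*f]) (≤-reflexive (m*n/n≡m Z (X * f)))
    where
    X*Y*Z≤Z*[X*f] : X * Y * Z ≤ Z * (X * f)
    X*Y*Z≤Z*[X*f] = ≤-trans (*-monoˡ-≤ Z (*-monoʳ-≤ X 2^r≤f)) (≤-reflexive (*-comm (X * f) Z))
  floor-eq : (2 ^ (ℓ + (r + (s + k * N)))) div (X * f) ≡ sum (replicate Z block) + t
  floor-eq = begin
    (2 ^ (ℓ + (r + (s + k * N)))) div (X * f)   ≡⟨ div≡/ _ (X * f) ⟩
    2 ^ (ℓ + (r + (s + k * N))) / (X * f)       ≡⟨ cong (_/ (X * f)) (2^-expansion {k} ℓ r s 1≤N f*B+1≡2^N) ⟩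
    (X * Y * Z + Z * block * (X * f)) / (X * f) ≡⟨ [m+n*o]/o≡n+m/o (X * Y * Z) (Z * block) (X * f) ⟩
    Z * block + t                               ≡⟨ cong (_+ t) (sum-replicate Z block) ⟨
    sum (replicate Z block) + t                 ∎

lemma13 : (k g ℓ f : ℕ) → 2 ≤ k → 1 ≤ f → f % 2 ≡ 1 → g ≡ 2 ^ ℓ * f →
    (n : ℕ) → f * 2 ^ (k * f + ℓ) ≤ 2 ^ n →
    ∃[ xs ] ∃[ t ]
    (length xs ≤ 2 ^ (k * f ∸ 1) × All (BinaryPower k) xs × t ≤ 2 ^ (k * f ∸ 1) ×
    (2 ^ n) div g ≡ sum xs + t)
lemma13 k g ℓ zero _ () _ _ _ _
lemma13 k g ℓ f@(suc _) 2≤k 1≤f odd refl n f*2^[kf+ℓ]≤2^n =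
  let (r , 2^r≤f , f<2^1+r) = binary-length 1≤f
      (d , 1≤d , d≤f , f∣2^d∸1) = multiplicative-period (odd⇒coprime-2 odd)
      ℓ+r+kf≤n = exponent-bound {m = k * f} {ℓ} {n} 2^r≤f f*2^[kf+ℓ]≤2^n
      (s , j , 1≤j , s<kf , n≡) = exponent-split {e = ℓ + r} (<⇒≤ 2≤k) 1≤d d≤f ℓ+r+kf≤n
      r<d = 2^-cancel-< {r} {d} (≤-<-trans 2^r≤f (∣-pred⇒< (^-monoʳ-≤ 2 1≤d) f∣2^d∸1))
      r<j*d = <-≤-trans r<d (m≤n*m d j {{>-nonZero 1≤j}})
      f∣2^[j*d]∸1 = ∣-trans f∣2^d∸1 (2^N∸1∣2^[k*N]∸1 j d)
      (xs , t , |xs|≡2^s , xs-powers , t≤2^s , 2^n/g≡) =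
        quotient-decomposition {k} ℓ s 2^r≤f f<2^1+r r<j*d f∣2^[j*d]∸1
      2^s≤2^[kf∸1] = ^-monoʳ-≤ 2 (<⇒≤pred s<kf)
  in xs , t , ≤-trans (≤-reflexive |xs|≡2^s) 2^s≤2^[kf∸1] , xs-powers , ≤-trans t≤2^s 2^s≤2^[kf∸1] ,
     subst (λ m → (2 ^ m) div (2 ^ ℓ * f) ≡ sum xs + t) (sym (trans n≡ (+-assoc ℓ r _))) 2^n/g≡
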